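{- Let $s\geq 1$ and $n\geq 2$ be integers and put $t=n+s-1$. Then $$M_s(n)\leq \begin{cases} \dfrac{n+\sqrt{t}}{s}+2, & \text{if } \sqrt{t}\in\mathbb{Z} \text{ and } s\mid (n+\sqrt{t}),\\[2mm] \left\lceil \dfrac{n+\sqrt{t}}{s}\right\rceil+1, & \text{otherwise.}\end{cases}$$
   Context: For integers $c,s\geq 1$, $K_{c\times s}$ denotes the complete multipartite graph with $c$ classes of $s$ vertices each. For a subgraph $H$ of $K_{c\times s}$, $\overline{H}$ denotes the complement of $H$ relative to $K_{c\times s}$. $C_4$ is the $4$-cycle and $K_{1,n}$ is the star with $n+1$ vertices. $M_s(n)$ is the smallest positive integer $c$ such that for every subgraph $H$ of $K_{c\times s}$, $H$ contains a copy of $C_4$ or $\overline{H}$ contains a copy of $K_{1,n}$. -}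

module Defs where

open import Data.Nat using (ℕ; _+_; _*_; _∸_; _≤_; _<_)
open import Data.Fin using (Fin)
open import Data.Bool using (Bool; true; false)
open import Data.Product using (Σ; _×_; ∃; ∃-syntax)
open import Data.Sum using (_⊎_)
open import Relation.Binary.PropositionalEquality using (_≡_; _≢_)
open import Function.Definitions using (Injective)

-- Vertices of K_{c×s}: a class index in Fin c and a position in Fin s.
Vertex : ℕ → ℕ → Set
Vertex c s = Fin c × Fin s

class : ∀ {c s} → Vertex c s → Fin c
class (i Data.Product., _) = i

KAdj : ∀ {c s} → Vertex c s → Vertex c s → Set
KAdj u v = class u ≢ class v

-- A subgraph H of K_{c×s} (on the vertex set of K_{c×s}; the complement is
-- taken relative to K_{c×s}).
record Subgraph (c s : ℕ) : Set where
  field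
    adj   : Vertex c s → Vertex c s → Bool
    sym   : ∀ u v → adj u v ≡ adj v u
    inK   : ∀ u v → adj u v ≡ true → KAdj u v

open Subgraph public

HasC4 : ∀ {c s} → Subgraph c s → Set
HasC4 {c} {s} H =
  Σ (Vertex c s) λ v0 → Σ (Vertex c s) λ v1 → Σ (Vertex c s) λ v2 → Σ (Vertex c s) λ v3 →
    (v0 ≢ v1) × (v0 ≢ v2) × (v0 ≢ v3) × (v1 ≢ v2) × (v1 ≢ v3) × (v2 ≢ v3) ×
    (adj H v0 v1 ≡ true) × (adj H v1 v2 ≡ true) × (adj H v2 v3 ≡ true) × (adj H v3 v0 ≡ true)

-- The complement of H relative to K_{c×s} contains a copy of K_{1,n}:
-- a centre v and n distinct leaves, each adjacent to v in K_{c×s} but not in H.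
-- (Leaves are automatically distinct from v, being in a different class.)
CompHasStar : ∀ {c s} → ℕ → Subgraph c s → Set
CompHasStar {c} {s} n H =
  Σ (Vertex c s) λ v → Σ (Fin n → Vertex c s) λ leaf →
    Injective _≡_ _≡_ leaf ×
    (∀ i → KAdj v (leaf i) × (adj H v (leaf i) ≡ false))

RamseyProp : ℕ → ℕ → ℕ → Set
RamseyProp s n c = (H : Subgraph c s) → HasC4 H ⊎ CompHasStar n H

IsM : ℕ → ℕ → ℕ → Set
IsM s n c = (1 ≤ c) × RamseyProp s n c × (∀ c' → 1 ≤ c' → RamseyProp s n c' → c ≤ c')

-- AtLeast s n t m  means  n + √t ≤ m·s  (for natural numbers m),
-- i.e. m·s ≥ n and (m·s − n)² ≥ t.
AtLeast : ℕ → ℕ → ℕ → ℕ → Set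
AtLeast s n t m = (n ≤ m * s) × (t ≤ (m * s ∸ n) * (m * s ∸ n))

-- IsCeil s n t m  means  m = ⌈(n + √t)/s⌉ : the least natural number m with
-- m ≥ (n + √t)/s  (the quantity is positive, so natural m suffice).
IsCeil : ℕ → ℕ → ℕ → ℕ → Set
IsCeil s n t m = AtLeast s n t m × (∀ k → AtLeast s n t k → m ≤ k)

-- If c s = n + s + z with n + s ≤ z², no subgraph H of K_{c×s} avoids both a C₄ and a
-- complementary K_{1,n}.  Otherwise every vertex misses at most s + n − 1 vertices (its own
-- class and fewer than n complementary neighbours), so it has more than z neighbours, and for
-- each neighbour u of a vertex v at least z vertices w ≠ v are adjacent to u.  Without a C₄
-- these sets are disjoint for distinct u, giving the Moore-type bound
-- 1 + (z + 1) z ≤ c s = n + s + z ≤ z² + z, which is absurd.  The two bounds are the cases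
-- z = √t + s and z = ⌈(n + √t)/s⌉ s − n, where z² > t except when √t is an integer with
-- s ∣ n + √t.  Finally RamseyProp is decidable (subgraphs are finitely many Boolean tables),
-- so the least admissible c exists.

module Submission where

open import Defs hiding (sym)

open import Data.Bool using (Bool; true; false)
import Data.Bool.Properties as Bool
open import Data.Empty using (⊥; ⊥-elim)
open import Data.Fin using (Fin; inject≤; fromℕ<)
import Data.Fin.Properties as Fin
open import Data.Fin.Properties using (injective⇒≤; inject≤-injective; any?; all?; *↔×)
open import Data.Fin.Subset using (Subset)
open import Data.Fin.Subset.Properties using (anySubset?)
open import Data.List using (List; []; _∷_; _++_; length; lookup; map; concatMap; allFin; filter)
open import Data.List.Properties using (length-map; length-tabulate; length-++)
open import Data.List.Membership.Propositional using (_∈_)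
open import Data.List.Membership.Propositional.Properties
  using (∈-lookup; ∈-map⁺; ∈-map⁻; ∈-allFin; ∈-filter⁺; ∈-filter⁻; ∈-++⁺ˡ; ∈-++⁺ʳ)
open import Data.List.Relation.Binary.Disjoint.Propositional using (Disjoint)
open import Data.List.Relation.Binary.Subset.Propositional using (_⊆_)
open import Data.List.Relation.Unary.All using (All; []; _∷_)
import Data.List.Relation.Unary.All as All
import Data.List.Relation.Unary.All.Properties as All
open import Data.List.Relation.Unary.All.Properties using (all-filter)
open import Data.List.Relation.Unary.AllPairs using (_∷_)
import Data.List.Relation.Unary.AllPairs as AllPairs
import Data.List.Relation.Unary.AllPairs.Properties as AllPairs
open import Data.List.Relation.Unary.Any using (here; there; index)
open import Data.List.Relation.Unary.Any.Properties using (lookup-index)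
open import Data.List.Relation.Unary.Unique.Propositional using (Unique)
import Data.List.Relation.Unary.Unique.Propositional.Properties as Unique
open import Data.Nat using (ℕ; zero; suc; _+_; _*_; _∸_; _≤_; _<_; z≤n; s≤s; _≤?_)
open import Data.Nat.Divisibility using (_∣_; divides)
open import Data.Nat.Properties
  using (≤-trans; ≤-reflexive; ≰⇒>; ≤∧≢⇒<; n≮n; m≤m+n; m≤n+m; m<m+n; m+[n∸m]≡n; +-comm; +-assoc;
         *-suc; *-identityʳ; *-distribʳ-+; +-mono-≤; +-monoʳ-≤; +-monoʳ-<; *-mono-≤; *-monoˡ-≤; *-mono-<;
         +-cancelʳ-≤; +-cancelʳ-<; module ≤-Reasoning)
open import Data.Nat.Tactic.RingSolver using (solve-∀)
open import Data.Product using (Σ; _×_; _,_; ∃; ∃-syntax; proj₁; proj₂; uncurry)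
open import Data.Product.Function.NonDependent.Propositional using (_×-↔_)
open import Data.Product.Properties using (≡-dec)
open import Data.Sum using (_⊎_; inj₁; inj₂)
import Data.Vec as Vec
import Data.Vec.Properties as Vec
open import Function.Base using (_∘_)
open import Function.Bundles using (_↔_; Inverse)
open import Function.Properties.Inverse using (↔-trans)
open import Relation.Binary.PropositionalEquality
  using (_≡_; _≢_; refl; sym; trans; cong; subst; module ≡-Reasoning)
open import Relation.Nullary using (Dec; yes; no; ¬_)
open import Relation.Nullary.Decidable using (map′; ¬?; _×-dec_; _⊎-dec_; _→-dec_; decidable-stable)
open import Relation.Unary using (Decidable)

module _ {A : Set} where

  lookup-injective : ∀ {xs : List A} → Unique xs → ∀ {i j} → lookup xs i ≡ lookup xs j → i ≡ j
  lookup-injective {_ ∷ _} _ {Fin.zero} {Fin.zero} _ = refl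
  lookup-injective {_ ∷ _} (x∉xs ∷ _) {Fin.zero} {Fin.suc j} eq = ⊥-elim (All.lookup x∉xs (∈-lookup j) eq)
  lookup-injective {_ ∷ _} (x∉xs ∷ _) {Fin.suc i} {Fin.zero} eq = ⊥-elim (All.lookup x∉xs (∈-lookup i) (sym eq))
  lookup-injective {_ ∷ _} (_ ∷ u) {Fin.suc i} {Fin.suc j} eq = cong Fin.suc (lookup-injective u eq)

  Unique-⊆⇒length-≤ : ∀ {xs ys : List A} → Unique xs → xs ⊆ ys → length xs ≤ length ys
  Unique-⊆⇒length-≤ {xs} {ys} u xs⊆ys = injective⇒≤ {f = position} position-injective
    where
    position : Fin (length xs) → Fin (length ys)
    position i = index (xs⊆ys (∈-lookup i))
    position-injective : ∀ {i j} → position i ≡ position j → i ≡ j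
    position-injective {i} {j} eq = lookup-injective u (begin
      lookup xs i             ≡⟨ lookup-index (xs⊆ys (∈-lookup i)) ⟩
      lookup ys (position i)  ≡⟨ cong (lookup ys) eq ⟩
      lookup ys (position j)  ≡⟨ sym (lookup-index (xs⊆ys (∈-lookup j))) ⟩
      lookup xs j             ∎)
      where open ≡-Reasoning

module _ {A B : Set} (f : A → List B) {k : ℕ} where

  length-concatMap-≥ : ∀ {xs} → All (λ x → k ≤ length (f x)) xs → length xs * k ≤ length (concatMap f xs)
  length-concatMap-≥ {[]} [] = z≤n
  length-concatMap-≥ {x ∷ xs} (k≤fx ∷ rest) =
    ≤-trans (+-mono-≤ k≤fx (length-concatMap-≥ rest)) (≤-reflexive (sym (length-++ (f x))))

module _ {A : Set} {k : ℕ} (e : Fin k ↔ A) where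
  open Inverse e

  enumerate : List A
  enumerate = map to (allFin k)

  enumerate-unique : Unique enumerate
  enumerate-unique = Unique.map⁺ to-injective (Unique.allFin⁺ k)
    where
    to-injective : ∀ {i j} → to i ≡ to j → i ≡ j
    to-injective {i} {j} eq = trans (sym (strictlyInverseʳ i)) (trans (cong from eq) (strictlyInverseʳ j))

  ∈-enumerate : ∀ x → x ∈ enumerate
  ∈-enumerate x = subst (_∈ enumerate) (strictlyInverseˡ x) (∈-map⁺ to (∈-allFin (from x)))

  length-enumerate : length enumerate ≡ k
  length-enumerate = trans (length-map to (allFin k)) (length-tabulate _)

module _ {A : Set} {k : ℕ} (e : Fin k ↔ A) {P : A → Set} (P? : Decidable P) where
  open Inverse e

  any↔? : Dec (Σ A P)
  any↔? = map′ (λ (i , p) → to i , p) (λ (x , p) → from x , subst P (sym (strictlyInverseˡ x)) p)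
               (any? (λ i → P? (to i)))

  all↔? : Dec (∀ x → P x)
  all↔? = map′ (λ h x → subst P (strictlyInverseˡ x) (h (from x))) (λ h i → h (to i)) (all? (λ i → P? (to i)))

all-subsets? : ∀ {k} {P : Subset k → Set} → Decidable P → Dec (∀ p → P p)
all-subsets? P? = map′ (λ ¬counterexample p → decidable-stable (P? p) (λ ¬Pp → ¬counterexample (p , ¬Pp)))
                       (λ ∀P (p , ¬Pp) → ¬Pp (∀P p))
                       (¬? (anySubset? (λ p → ¬? (P? p))))

least : ∀ {P : ℕ → Set} → Decidable P → ∀ m → P m → Σ ℕ λ M → P M × (∀ k → P k → M ≤ k)
least P? zero p = zero , p , λ _ _ → z≤n
least P? (suc m) p with P? zero
... | yes p0 = zero , p0 , λ _ _ → z≤n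
... | no ¬p0 with least (λ k → P? (suc k)) m p
...   | M , pM , minimal = suc M , pM , λ where
          zero p0 → ⊥-elim (¬p0 p0)
          (suc k) pk → s≤s (minimal k pk)

module _ {c s : ℕ} where

  vertexIndex : Fin (c * s) ↔ Vertex c s
  vertexIndex = *↔×

  vertices : List (Vertex c s)
  vertices = enumerate vertexIndex

  vertices-unique : Unique vertices
  vertices-unique = enumerate-unique vertexIndex

  ∈-vertices : ∀ v → v ∈ vertices
  ∈-vertices = ∈-enumerate vertexIndex

  length-vertices : length vertices ≡ c * s
  length-vertices = length-enumerate vertexIndex

  anyVertex? : {P : Vertex c s → Set} → Decidable P → Dec (Σ (Vertex c s) P)
  anyVertex? = any↔? vertexIndex

  allVertices? : {P : Vertex c s → Set} → Decidable P → Dec (∀ v → P v)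
  allVertices? = all↔? vertexIndex

  vertices-⊆⇒c*s≤length : ∀ {xs} → vertices ⊆ xs → c * s ≤ length xs
  vertices-⊆⇒c*s≤length {xs} ⊆xs = subst (_≤ length xs) length-vertices (Unique-⊆⇒length-≤ vertices-unique ⊆xs)

  _≟ᵥ_ : (u w : Vertex c s) → Dec (u ≡ w)
  _≟ᵥ_ = ≡-dec Fin._≟_ Fin._≟_

  classRow : Fin c → List (Vertex c s)
  classRow i = map (i ,_) (allFin s)

  length-classRow : ∀ i → length (classRow i) ≡ s
  length-classRow i = trans (length-map (i ,_) (allFin s)) (length-tabulate _)

  ∈-classRow : ∀ {w i} → class w ≡ i → w ∈ classRow i
  ∈-classRow {_ , j} refl = ∈-map⁺ (_ ,_) (∈-allFin j)

  module _ (H : Subgraph c s) where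

    adjacent? : ∀ u w → Dec (adj H u w ≡ true)
    adjacent? u w = adj H u w Bool.≟ true

    neighbours : Vertex c s → List (Vertex c s)
    neighbours u = filter (adjacent? u) vertices

    CoAdjacent : Vertex c s → Vertex c s → Set
    CoAdjacent u w = KAdj u w × adj H u w ≡ false

    coAdjacent? : ∀ u w → Dec (CoAdjacent u w)
    coAdjacent? u w = ¬? (class u Fin.≟ class w) ×-dec adj H u w Bool.≟ false

    coNeighbours : Vertex c s → List (Vertex c s)
    coNeighbours u = filter (coAdjacent? u) vertices

    PathEnd : Vertex c s → Vertex c s → Vertex c s → Set
    PathEnd v u w = adj H v u ≡ true × adj H u w ≡ true × w ≢ v

    pathEnd? : ∀ v u w → Dec (PathEnd v u w)
    pathEnd? v u w = adjacent? v u ×-dec adjacent? u w ×-dec ¬? (w ≟ᵥ v)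

    pathEnds : Vertex c s → Vertex c s → List (Vertex c s)
    pathEnds v u = filter (pathEnd? v u) vertices

    adjacent⇒≢ : ∀ {u w} → adj H u w ≡ true → u ≢ w
    adjacent⇒≢ {u} uw refl = inK H u u uw refl

    star⇒many-coNeighbours : ∀ {n} → CompHasStar n H → ∃ λ v → n ≤ length (coNeighbours v)
    star⇒many-coNeighbours {n} (v , leaf , leaf-injective , coAdjacent-leaf) = v , (begin
      n                              ≡⟨ sym (trans (length-map leaf (allFin n)) (length-tabulate _)) ⟩
      length (map leaf (allFin n))   ≤⟨ Unique-⊆⇒length-≤ (Unique.map⁺ leaf-injective (Unique.allFin⁺ n)) leaves⊆ ⟩
      length (coNeighbours v)        ∎)
      where
      open ≤-Reasoning
      leaves⊆ : map leaf (allFin n) ⊆ coNeighbours v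
      leaves⊆ w∈ with ∈-map⁻ leaf w∈
      ... | i , _ , refl = ∈-filter⁺ (coAdjacent? v) (∈-vertices (leaf i)) (coAdjacent-leaf i)

    many-coNeighbours⇒star : ∀ {n} v → n ≤ length (coNeighbours v) → CompHasStar n H
    many-coNeighbours⇒star v n≤ =
      v , leaf , leaf-injective , λ i → proj₂ (∈-filter⁻ (coAdjacent? v) {xs = vertices} (∈-lookup (inject≤ i n≤)))
      where
      leaf = λ i → lookup (coNeighbours v) (inject≤ i n≤)
      leaf-injective : ∀ {i j} → leaf i ≡ leaf j → i ≡ j
      leaf-injective {i} {j} eq =
        inject≤-injective n≤ n≤ i j (lookup-injective (Unique.filter⁺ (coAdjacent? v) vertices-unique) eq)

    compHasStar? : ∀ n → Dec (CompHasStar n H)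
    compHasStar? n = map′ (λ (v , n≤) → many-coNeighbours⇒star v n≤) star⇒many-coNeighbours
                          (anyVertex? (λ v → n ≤? length (coNeighbours v)))

    hasC4? : Dec (HasC4 H)
    hasC4? = anyVertex? λ v₀ → anyVertex? λ v₁ → anyVertex? λ v₂ → anyVertex? λ v₃ →
      ¬? (v₀ ≟ᵥ v₁) ×-dec ¬? (v₀ ≟ᵥ v₂) ×-dec ¬? (v₀ ≟ᵥ v₃) ×-dec ¬? (v₁ ≟ᵥ v₂) ×-dec ¬? (v₁ ≟ᵥ v₃) ×-dec
      ¬? (v₂ ≟ᵥ v₃) ×-dec adjacent? v₀ v₁ ×-dec adjacent? v₁ v₂ ×-dec adjacent? v₂ v₃ ×-dec adjacent? v₃ v₀

    ¬star⇒few-coNeighbours : ∀ {n} → ¬ CompHasStar n H → ∀ u → length (coNeighbours u) < n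
    ¬star⇒few-coNeighbours ¬star u = ≰⇒> λ n≤ → ¬star (many-coNeighbours⇒star u n≤)

    adjacent⊎classmate⊎coAdjacent : ∀ u w → adj H u w ≡ true ⊎ class w ≡ class u ⊎ CoAdjacent u w
    adjacent⊎classmate⊎coAdjacent u w with adj H u w | class u Fin.≟ class w
    ... | true  | _        = inj₁ refl
    ... | false | yes same = inj₂ (inj₁ (sym same))
    ... | false | no  diff = inj₂ (inj₂ (diff , refl))

    length-++-classRow : ∀ xs (u : Vertex c s) ys →
                         length (xs ++ (classRow (class u) ++ ys)) ≡ length xs + (s + length ys)
    length-++-classRow xs u ys = trans (length-++ xs {classRow (class u) ++ ys})
      (cong (length xs +_) (trans (length-++ (classRow (class u)) {ys})
                                  (cong (_+ length ys) (length-classRow (class u)))))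

    vertices-⊆-neighbours : ∀ u → vertices ⊆ neighbours u ++ (classRow (class u) ++ coNeighbours u)
    vertices-⊆-neighbours u {w} _ with adjacent⊎classmate⊎coAdjacent u w
    ... | inj₁ uw          = ∈-++⁺ˡ (∈-filter⁺ (adjacent? u) (∈-vertices w) uw)
    ... | inj₂ (inj₁ same) = ∈-++⁺ʳ (neighbours u) (∈-++⁺ˡ (∈-classRow same))
    ... | inj₂ (inj₂ co)   =
      ∈-++⁺ʳ (neighbours u) (∈-++⁺ʳ (classRow (class u)) (∈-filter⁺ (coAdjacent? u) (∈-vertices w) co))

    vertices-⊆-pathEnds : ∀ {v u} → adj H v u ≡ true →
                          vertices ⊆ v ∷ (pathEnds v u ++ (classRow (class u) ++ coNeighbours u))
    vertices-⊆-pathEnds {v} {u} vu {w} _ with w ≟ᵥ v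
    ... | yes refl = here refl
    ... | no w≢v with adjacent⊎classmate⊎coAdjacent u w
    ...   | inj₁ uw          = there (∈-++⁺ˡ (∈-filter⁺ (pathEnd? v u) (∈-vertices w) (vu , uw , w≢v)))
    ...   | inj₂ (inj₁ same) = there (∈-++⁺ʳ (pathEnds v u) (∈-++⁺ˡ (∈-classRow same)))
    ...   | inj₂ (inj₂ co)   =
      there (∈-++⁺ʳ (pathEnds v u) (∈-++⁺ʳ (classRow (class u)) (∈-filter⁺ (coAdjacent? u) (∈-vertices w) co)))

    ¬star⇒many-neighbours : ∀ {n} → ¬ CompHasStar n H → ∀ u → c * s < length (neighbours u) + (s + n)
    ¬star⇒many-neighbours {n} ¬star u = begin-strict
      c * s
        ≤⟨ vertices-⊆⇒c*s≤length (vertices-⊆-neighbours u) ⟩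
      length (neighbours u ++ (classRow (class u) ++ coNeighbours u))
        ≡⟨ length-++-classRow (neighbours u) u (coNeighbours u) ⟩
      length (neighbours u) + (s + length (coNeighbours u))
        <⟨ +-monoʳ-< (length (neighbours u)) (+-monoʳ-< s (¬star⇒few-coNeighbours ¬star u)) ⟩
      length (neighbours u) + (s + n) ∎
      where open ≤-Reasoning

    ¬star⇒many-pathEnds : ∀ {n} → ¬ CompHasStar n H → ∀ {v u} → adj H v u ≡ true →
                          c * s ≤ length (pathEnds v u) + (s + n)
    ¬star⇒many-pathEnds {n} ¬star {v} {u} vu = begin
      c * s
        ≤⟨ vertices-⊆⇒c*s≤length (vertices-⊆-pathEnds vu) ⟩
      suc (length (pathEnds v u ++ (classRow (class u) ++ coNeighbours u)))
        ≡⟨ cong suc (length-++-classRow (pathEnds v u) u (coNeighbours u)) ⟩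
      suc (length (pathEnds v u) + (s + length (coNeighbours u)))
        ≤⟨ +-monoʳ-< (length (pathEnds v u)) (+-monoʳ-< s (¬star⇒few-coNeighbours ¬star u)) ⟩
      length (pathEnds v u) + (s + n) ∎
      where open ≤-Reasoning

    -- For distinct neighbours u, u′ of v a common end w would close the 4-cycle v u w u′.
    C4-free⇒pathEnds-disjoint : ¬ HasC4 H → ∀ {v u u′} → u ≢ u′ → Disjoint (pathEnds v u) (pathEnds v u′)
    C4-free⇒pathEnds-disjoint ¬c4 {v} {u} {u′} u≢u′ {w} (w∈ , w∈′)
      with (vu , uw , w≢v) ← proj₂ (∈-filter⁻ (pathEnd? v u) {xs = vertices} w∈)
         | (vu′ , u′w , _) ← proj₂ (∈-filter⁻ (pathEnd? v u′) {xs = vertices} w∈′) =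
      ¬c4 (v , u , w , u′ , adjacent⇒≢ vu , w≢v ∘ sym , adjacent⇒≢ vu′ , adjacent⇒≢ uw , u≢u′ ,
           adjacent⇒≢ wu′ , vu , uw , wu′ , trans (Subgraph.sym H u′ v) vu′)
      where wu′ = trans (Subgraph.sym H w u′) u′w

    C4-free⇒moore-bound : ¬ HasC4 H → ∀ {k} v → All (λ u → k ≤ length (pathEnds v u)) (neighbours v) →
                          suc (length (neighbours v) * k) ≤ c * s
    C4-free⇒moore-bound ¬c4 {k} v bounds = begin
      suc (length (neighbours v) * k)        ≤⟨ s≤s (length-concatMap-≥ (pathEnds v) bounds) ⟩
      length (v ∷ ends)                      ≤⟨ Unique-⊆⇒length-≤ walk-unique (λ {w} _ → ∈-vertices w) ⟩
      length vertices                        ≡⟨ length-vertices ⟩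
      c * s                                  ∎
      where
      open ≤-Reasoning
      ends = concatMap (pathEnds v) (neighbours v)
      pathEnds-unique : ∀ u → Unique (pathEnds v u)
      pathEnds-unique u = Unique.filter⁺ (pathEnd? v u) vertices-unique
      v∉pathEnds : ∀ u → All (v ≢_) (pathEnds v u)
      v∉pathEnds u = All.map (λ (_ , _ , w≢v) v≡w → w≢v (sym v≡w)) (all-filter (pathEnd? v u) vertices)
      walk-unique : Unique (v ∷ ends)
      walk-unique = All.concat⁺ (All.map⁺ (All.universal v∉pathEnds (neighbours v)))
                  ∷ Unique.concat⁺ (All.map⁺ (All.universal pathEnds-unique (neighbours v)))
                      (AllPairs.map⁺ (AllPairs.map (C4-free⇒pathEnds-disjoint ¬c4)
                                                   (Unique.filter⁺ (adjacent? v) vertices-unique)))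

moore-contradiction : ∀ {N m z d} → N ≡ z + m → m ≤ z * z → z < d → suc (d * z) ≤ N → ⊥
moore-contradiction {N} {m} {z} {d} N≡ m≤z² z<d moore = n≮n (z + z * z) (begin-strict
  z + z * z  ≤⟨ *-monoˡ-≤ z z<d ⟩
  d * z      <⟨ moore ⟩
  N          ≡⟨ N≡ ⟩
  z + m      ≤⟨ +-monoʳ-≤ z m≤z² ⟩
  z + z * z  ∎)
  where open ≤-Reasoning

ramsey-of-excess : ∀ {c s n} z → 1 ≤ s → c * s ≡ n + s + z → n + s ≤ z * z → RamseyProp s n c
ramsey-of-excess {c} {s} {n} z 1≤s cs≡ n+s≤z² H with compHasStar? H n
... | yes star = inj₂ star
... | no ¬star with hasC4? H
...   | yes c4  = inj₁ c4
...   | no ¬c4  = ⊥-elim (moore-contradiction cs≡z+m (subst (_≤ z * z) (+-comm n s) n+s≤z²) z<degree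
                                               (C4-free⇒moore-bound H ¬c4 v z≤ends))
  where
  cs≡z+m : c * s ≡ z + (s + n)
  cs≡z+m = trans cs≡ (trans (+-comm (n + s) z) (cong (z +_) (+-comm n s)))
  0<cs : 0 < c * s
  0<cs = subst (0 <_) (sym cs≡z+m) (≤-trans 1≤s (≤-trans (m≤m+n s n) (m≤n+m (s + n) z)))
  v : Vertex c s
  v = Inverse.to vertexIndex (fromℕ< 0<cs)
  z<degree : z < length (neighbours H v)
  z<degree = +-cancelʳ-< (s + n) z _
    (subst (_< length (neighbours H v) + (s + n)) cs≡z+m (¬star⇒many-neighbours H ¬star v))
  z≤ends : All (λ u → z ≤ length (pathEnds H v u)) (neighbours H v)
  z≤ends = All.tabulate λ {u} u∈ → +-cancelʳ-≤ (s + n) z _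
    (subst (_≤ length (pathEnds H v u) + (s + n)) cs≡z+m
      (¬star⇒many-pathEnds H ¬star (proj₂ (∈-filter⁻ (adjacent? H v) {xs = vertices} u∈))))

module _ {c s : ℕ} where

  C4⊎star-cong : ∀ {n} {H H′ : Subgraph c s} → (∀ u w → adj H u w ≡ adj H′ u w) →
                 HasC4 H ⊎ CompHasStar n H → HasC4 H′ ⊎ CompHasStar n H′
  C4⊎star-cong H≗H′ (inj₁ (v₀ , v₁ , v₂ , v₃ , d₀₁ , d₀₂ , d₀₃ , d₁₂ , d₁₃ , d₂₃ , e₀₁ , e₁₂ , e₂₃ , e₃₀)) =
    inj₁ (v₀ , v₁ , v₂ , v₃ , d₀₁ , d₀₂ , d₀₃ , d₁₂ , d₁₃ , d₂₃ ,
          edge e₀₁ , edge e₁₂ , edge e₂₃ , edge e₃₀)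
    where edge = λ {u w} e → trans (sym (H≗H′ u w)) e
  C4⊎star-cong H≗H′ (inj₂ (v , leaf , leaf-injective , coAdjacent-leaf)) =
    inj₂ (v , leaf , leaf-injective ,
          λ i → proj₁ (coAdjacent-leaf i) , trans (sym (H≗H′ v (leaf i))) (proj₂ (coAdjacent-leaf i)))

  edgeIndex : Fin ((c * s) * (c * s)) ↔ (Vertex c s × Vertex c s)
  edgeIndex = ↔-trans *↔× (vertexIndex ×-↔ vertexIndex)

  Table : Set
  Table = Subset ((c * s) * (c * s))

  tableAdj : Table → Vertex c s → Vertex c s → Bool
  tableAdj t u w = Vec.lookup t (Inverse.from edgeIndex (u , w))

  IsSubgraphTable : Table → Set
  IsSubgraphTable t = (∀ u w → tableAdj t u w ≡ tableAdj t w u) ×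
                      (∀ u w → tableAdj t u w ≡ true → KAdj u w)

  isSubgraphTable? : ∀ t → Dec (IsSubgraphTable t)
  isSubgraphTable? t =
    allVertices? (λ u → allVertices? λ w → tableAdj t u w Bool.≟ tableAdj t w u) ×-dec
    allVertices? (λ u → allVertices? λ w → (tableAdj t u w Bool.≟ true) →-dec ¬? (class u Fin.≟ class w))

  decode : ∀ t → IsSubgraphTable t → Subgraph c s
  decode t (symmetric , inK-table) = record { adj = tableAdj t ; sym = symmetric ; inK = inK-table }

  encode : Subgraph c s → Table
  encode H = Vec.tabulate (λ i → uncurry (adj H) (Inverse.to edgeIndex i))

  tableAdj-encode : ∀ H u w → tableAdj (encode H) u w ≡ adj H u w
  tableAdj-encode H u w = trans (Vec.lookup∘tabulate _ (Inverse.from edgeIndex (u , w)))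
                                (cong (uncurry (adj H)) (Inverse.strictlyInverseˡ edgeIndex (u , w)))

  encode-isSubgraphTable : ∀ H → IsSubgraphTable (encode H)
  encode-isSubgraphTable H =
    (λ u w → trans (tableAdj-encode H u w) (trans (Subgraph.sym H u w) (sym (tableAdj-encode H w u)))) ,
    (λ u w uw → inK H u w (trans (sym (tableAdj-encode H u w)) uw))

  RamseyForTables : ℕ → Set
  RamseyForTables n = ∀ t (ok : IsSubgraphTable t) → HasC4 (decode t ok) ⊎ CompHasStar n (decode t ok)

  ramseyForTables? : ∀ n → Dec (RamseyForTables n)
  ramseyForTables? n = all-subsets? ramseyForTable?
    where
    ramseyForTable? : ∀ t → Dec ((ok : IsSubgraphTable t) → HasC4 (decode t ok) ⊎ CompHasStar n (decode t ok))
    ramseyForTable? t with isSubgraphTable? t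
    ... | no ¬ok = yes λ ok → ⊥-elim (¬ok ok)
    -- HasC4 and CompHasStar read only adj, so r does not depend on the proof ok.
    ... | yes ok = map′ (λ r _ → r) (λ f → f ok) (hasC4? (decode t ok) ⊎-dec compHasStar? (decode t ok) n)

ramsey? : ∀ s n c → Dec (RamseyProp s n c)
ramsey? s n c = map′ fromTables (λ R t ok → R (decode t ok)) (ramseyForTables? n)
  where
  fromTables : RamseyForTables {c} {s} n → RamseyProp s n c
  fromTables R H =
    C4⊎star-cong {H = decode (encode H) ok} {H′ = H} (tableAdj-encode H) (R (encode H) ok)
    where ok = encode-isSubgraphTable H

suc[n+s∸1]≡n+s : ∀ {s} n → 1 ≤ s → suc (n + s ∸ 1) ≡ n + s
suc[n+s∸1]≡n+s {s} n 1≤s = m+[n∸m]≡n (≤-trans 1≤s (m≤n+m s n))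

ramsey-at-double : ∀ {s} n → 1 ≤ s → RamseyProp s n ((n + s) + (n + s))
ramsey-at-double {suc s′} n _ = ramsey-of-excess z (s≤s z≤n) (trans (*-suc (K + K) s′) (+-assoc K K _)) K≤z²
  where
  K = n + suc s′
  z = K + (K + K) * s′
  K≤z : K ≤ z
  K≤z = m≤m+n K _
  K≤z² : K ≤ z * z
  K≤z² = subst (_≤ z * z) (*-identityʳ K) (*-mono-≤ K≤z (≤-trans (≤-trans (s≤s z≤n) (m≤n+m (suc s′) n)) K≤z))

ramsey-at-square-root : ∀ {s n r q} → 1 ≤ s → r * r ≡ n + s ∸ 1 → n + r ≡ q * s → RamseyProp s n (q + 2)
ramsey-at-square-root {s} {n} {r} {q} 1≤s r²≡t n+r≡qs = ramsey-of-excess (r + s) 1≤s cs≡ n+s≤z²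
  where
  cs≡ : (q + 2) * s ≡ n + s + (r + s)
  cs≡ = begin
    (q + 2) * s     ≡⟨ *-distribʳ-+ s q 2 ⟩
    q * s + 2 * s   ≡⟨ cong (_+ 2 * s) (sym n+r≡qs) ⟩
    n + r + 2 * s   ≡⟨ regroup n r s ⟩
    n + s + (r + s) ∎
    where
    open ≡-Reasoning
    regroup : ∀ n r s → n + r + 2 * s ≡ n + s + (r + s)
    regroup = solve-∀
  n+s≤z² : n + s ≤ (r + s) * (r + s)
  n+s≤z² = subst (_≤ (r + s) * (r + s)) (trans (cong suc r²≡t) (suc[n+s∸1]≡n+s n 1≤s))
                 (*-mono-< (m<m+n r 1≤s) (m<m+n r 1≤s))

ramsey-above-ceiling : ∀ {s n m} → 1 ≤ s → ¬ (∃[ r ] (r * r ≡ n + s ∸ 1) × (s ∣ n + r)) →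
                       AtLeast s n (n + s ∸ 1) m → RamseyProp s n (m + 1)
ramsey-above-ceiling {s} {n} {m} 1≤s ¬root (n≤ms , t≤y²) = ramsey-of-excess y 1≤s cs≡ n+s≤y²
  where
  y = m * s ∸ n
  n+y≡ms : n + y ≡ m * s
  n+y≡ms = m+[n∸m]≡n n≤ms
  cs≡ : (m + 1) * s ≡ n + s + y
  cs≡ = begin
    (m + 1) * s  ≡⟨ *-distribʳ-+ s m 1 ⟩
    m * s + 1 * s ≡⟨ cong (_+ 1 * s) (sym n+y≡ms) ⟩
    n + y + 1 * s ≡⟨ regroup n y s ⟩
    n + s + y    ∎
    where
    open ≡-Reasoning
    regroup : ∀ n y s → n + y + 1 * s ≡ n + s + y
    regroup = solve-∀
  -- equality would make y a square root of t with s ∣ n + y = m s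
  t<y² : n + s ∸ 1 < y * y
  t<y² = ≤∧≢⇒< t≤y² λ t≡y² → ¬root (y , sym t≡y² , divides m n+y≡ms)
  n+s≤y² : n + s ≤ y * y
  n+s≤y² = subst (_≤ y * y) (suc[n+s∸1]≡n+s n 1≤s) t<y²

proposition3p1 : (s n : ℕ) → 1 ≤ s → 2 ≤ n →
    Σ ℕ λ M → IsM s n M ×
      ((r : ℕ) → r * r ≡ n + s ∸ 1 → s ∣ n + r →
         (q : ℕ) → n + r ≡ q * s → M ≤ q + 2) ×
      (¬ (∃[ r ] (r * r ≡ n + s ∸ 1) × (s ∣ n + r)) →
         (m : ℕ) → IsCeil s n (n + s ∸ 1) m → M ≤ m + 1)
proposition3p1 s n 1≤s _
  with least (λ c → 1 ≤? c ×-dec ramsey? s n c) (n + s + (n + s))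
             (≤-trans 1≤s (≤-trans (m≤n+m s n) (m≤m+n (n + s) (n + s))) , ramsey-at-double n 1≤s)
... | M , (1≤M , ramsey-M) , minimal =
  M , (1≤M , ramsey-M , λ c 1≤c ramsey-c → minimal c (1≤c , ramsey-c)) ,
  (λ r r²≡t _ q n+r≡qs →
     minimal (q + 2) (≤-trans (m≤n+m 1 1) (m≤n+m 2 q) , ramsey-at-square-root 1≤s r²≡t n+r≡qs)) ,
  (λ ¬root m (m-above , _) → minimal (m + 1) (m≤n+m 1 m , ramsey-above-ceiling 1≤s ¬root m-above))
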